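{- Let $n>2$, let $\mathcal D_n=\{e_0,\ldots,e_n\}\subseteq(C_3)^n$ be the canonical set and $\mathfrak M=\mathbf D((C_3)^n,\mathcal D_n)$. Then $\mathrm{Aut}(\mathfrak M)\cong S_{n+1}\ltimes(C_3)^n$, where $(C_3)^n$ is the normal subgroup of translations and $S_{n+1}$ is the stabilizer of the point $0$, acting on $(C_3)^n$ by the group automorphisms generated by the coordinate permutations and the maps $x\mapsto(x_1,\ldots,x_{s-1},-\sum_{i=1}^nx_i,x_{s+1},\ldots,x_n)$, $1\le s\le n$.
   Context: $C_3=\mathbb Z/3\mathbb Z$, $(C_3)^n$ written additively; $e_0=0$, $e_i$ the $i$-th standard unit vector. $\mathbf D(\mathsf G,D)$ is the incidence structure whose points are elements of $G$ and whose lines are the translates $b+D$, incidence being membership; $\mathrm{Aut}$ is its automorphism group (pairs of bijections of points and lines preserving and reflecting incidence). For $n=2$ the structure is the Pappus configuration. -}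

module Defs where

open import Data.Nat using (ℕ; zero; suc)
open import Data.Fin using (Fin; zero; suc)
open import Data.Vec using (Vec; []; _∷_; zipWith; map; replicate; foldr; lookup; tabulate; _[_]≔_)
open import Data.Product using (Σ; ∃; _×_; _,_)
open import Function.Bundles using (_↔_; Inverse; _⇔_)
open import Data.Fin.Permutation using (Permutation′; _⟨$⟩ʳ_; _∘ₚ_; transpose)
open import Relation.Binary.PropositionalEquality using (_≡_)

C₃ : Set
C₃ = Fin 3

infixl 6 _⊕_
_⊕_ : C₃ → C₃ → C₃
zero ⊕ y = y
suc zero ⊕ zero = suc zero
suc zero ⊕ suc zero = suc (suc zero)
suc zero ⊕ suc (suc zero) = zero
suc (suc zero) ⊕ zero = suc (suc zero)
suc (suc zero) ⊕ suc zero = zero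
suc (suc zero) ⊕ suc (suc zero) = suc zero

⊖_ : C₃ → C₃
⊖ zero = zero
⊖ suc zero = suc (suc zero)
⊖ suc (suc zero) = suc zero

Pt : ℕ → Set
Pt n = Vec C₃ n

infixl 6 _+ᵥ_
_+ᵥ_ : ∀ {n} → Pt n → Pt n → Pt n
_+ᵥ_ = zipWith _⊕_

0ᵥ : ∀ {n} → Pt n
0ᵥ {n} = replicate n zero

Σᵥ : ∀ {n} → Pt n → C₃
Σᵥ = foldr _ _⊕_ zero

-- e₀ = 0, e_{i} = i-th standard unit vector (i = 1..n); index suc i ↦ e_{i+1}
unit : ∀ {n} → Fin n → Pt n
unit {suc n} zero    = suc zero ∷ replicate n zero
unit {suc n} (suc i) = zero ∷ unit i

e : ∀ {n} → Fin (suc n) → Pt n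
e zero    = 0ᵥ
e (suc i) = unit i

-- The incidence structure D((C₃)ⁿ, Dₙ), Dₙ = {e₀,…,eₙ}.
-- Points: elements of (C₃)ⁿ.  Lines: translates b + Dₙ, indexed by b
-- (distinct b give distinct translates).  Incidence: x ∈ b + Dₙ.

_I_ : ∀ {n} → Pt n → Pt n → Set
_I_ {n} x b = ∃ λ (i : Fin (suc n)) → x ≡ b +ᵥ e i

record Aut (n : ℕ) : Set where
  field
    pt  : Pt n ↔ Pt n
    ln  : Pt n ↔ Pt n
    inc : ∀ x b → (x I b) ⇔ ((Inverse.to pt x) I (Inverse.to ln b))

open Aut public

ptMap : ∀ {n} → Aut n → Pt n → Pt n
ptMap α = Inverse.to (pt α)

lnMap : ∀ {n} → Aut n → Pt n → Pt n
lnMap α = Inverse.to (ln α)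

_≈ᴬ_ : ∀ {n} → Aut n → Aut n → Set
_≈ᴬ_ {n} α β = (∀ x → ptMap α x ≡ ptMap β x) × (∀ b → lnMap α b ≡ lnMap β b)

-- The symmetric group S_{n+1} = permutations of Fin (n+1),
-- product σ · τ = "first τ, then σ".

S : ℕ → Set
S n = Permutation′ n

infixl 7 _·_
_·_ : ∀ {n} → S n → S n → S n
σ · τ = τ ∘ₚ σ

φ : ∀ {n} → Fin n → Pt n → Pt n
φ s x = x [ s ]≔ (⊖ Σᵥ x)

swapᶜ : ∀ {n} → Fin n → Fin n → Pt n → Pt n
swapᶜ i j x = tabulate (λ k → lookup x (transpose i j ⟨$⟩ʳ k))

_≈ᴬ_∘ᴬ_ : ∀ {n} → Aut n → Aut n → Aut n → Set
_≈ᴬ_∘ᴬ_ γ α β =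
  (∀ x → ptMap γ x ≡ ptMap α (ptMap β x)) × (∀ b → lnMap γ b ≡ lnMap α (lnMap β b))

module Submission where

-- Every x ∈ (C₃)ⁿ has homogeneous coordinates x̂ = (−Σxᵢ, x₁, …, xₙ) ∈ C₃^{n+1}:
-- they sum to 0, determine x, and ê_a = δ_a − δ_0.  Permuting homogeneous
-- coordinates defines an action ρ of S_{n+1} on (C₃)ⁿ by group automorphisms
-- with ρ σ (e a) = e (σ a) − e (σ 0); the transpositions (0 s) and (i j) act as
-- φ s and as coordinate swaps.  Consequently x ↦ ρ σ x + b on points together
-- with c ↦ ρ σ c + b − e (σ 0) on lines is an automorphism Ψ σ b, and Ψ is an
-- injective homomorphism from the semidirect product.
--
-- Surjectivity: an automorphism (f, g) labels each line c by the injection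
-- π c with f (c + eᵢ) = g c + e (π c i).  A lemma on sums of three unit
-- vectors, applied to four distinct labels (this is where n > 2 enters),
-- shows that π c does not depend on c; with σ = π 0 an induction along unit
-- steps gives f = ρ σ (·) + f 0 and g = f − e (σ 0).

open import Defs
open import Data.Nat using (ℕ; zero; suc; _<_; s≤s; z≤n)
open import Data.Fin using (Fin; zero; suc; inject≤)
open import Data.Fin.Properties using (all?; any?; _≟_; inject≤-injective; <⇒notInjective)
open import Data.Fin.Permutation
  using (_≈_; transpose; _⟨$⟩ʳ_; _⟨$⟩ˡ_; flip; inverseˡ; inverseʳ; permutation; lift₀-transpose)
import Data.Fin.Permutation.Components as PC
open import Data.Vec using (Vec; []; _∷_; lookup; tabulate; map; replicate)
open import Data.Vec.Properties
  using (tabulate∘lookup; tabulate-cong; lookup∘tabulate; lookup∘update; lookup∘update′;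
         lookup-map; lookup-zipWith; lookup-replicate)
open import Data.Bool using (Bool; true; false)
open import Data.Product using (Σ; ∃; _×_; _,_; proj₁; proj₂)
open import Data.Sum using (_⊎_; inj₁; inj₂; [_,_]′)
open import Data.Empty using (⊥-elim)
open import Data.Unit using (tt)
open import Function.Base using (_∘_)
open import Function.Bundles using (Inverse; Equivalence; mk↔ₛ′; mk⇔)
open import Relation.Nullary using (¬_; Dec; yes; no; does)
open import Relation.Nullary.Decidable
  using (True; toWitness; map′; dec-true; dec-false; _→-dec_; _×-dec_; ¬?)
open import Algebra.Bundles using (CommutativeMonoid)
import Algebra.Properties.CommutativeMonoid.Sum as CommutativeMonoidSum
open import Relation.Binary.PropositionalEquality

⊕-assoc : ∀ a b c → a ⊕ b ⊕ c ≡ a ⊕ (b ⊕ c)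
⊕-assoc = toWitness {a? = all? λ a → all? λ b → all? λ c → a ⊕ b ⊕ c ≟ a ⊕ (b ⊕ c)} tt

⊕-comm : ∀ a b → a ⊕ b ≡ b ⊕ a
⊕-comm = toWitness {a? = all? λ a → all? λ b → a ⊕ b ≟ b ⊕ a} tt

⊕-identityʳ : ∀ a → a ⊕ zero ≡ a
⊕-identityʳ = toWitness {a? = all? λ a → a ⊕ zero ≟ a} tt

⊖-distrib-⊕ : ∀ a b → ⊖ (a ⊕ b) ≡ ⊖ a ⊕ ⊖ b
⊖-distrib-⊕ = toWitness {a? = all? λ a → all? λ b → ⊖ (a ⊕ b) ≟ ⊖ a ⊕ ⊖ b} tt

⊖-inverseˡ : ∀ a → ⊖ a ⊕ a ≡ zero
⊖-inverseˡ = toWitness {a? = all? λ a → ⊖ a ⊕ a ≟ zero} tt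

⊖-unique : ∀ a b → a ⊕ b ≡ zero → ⊖ b ≡ a
⊖-unique = toWitness {a? = all? λ a → all? λ b → (a ⊕ b ≟ zero) →-dec (⊖ b ≟ a)} tt

⊕-cancelʳ : ∀ a b c → a ⊕ c ≡ b ⊕ c → a ≡ b
⊕-cancelʳ = toWitness {a? = all? λ a → all? λ b → all? λ c → (a ⊕ c ≟ b ⊕ c) →-dec (a ≟ b)} tt

-- C₃ has exponent 3: subtracting the same element three times is invisible.
⊖-thrice : ∀ a b c z → (a ⊕ ⊖ z) ⊕ (b ⊕ ⊖ z) ⊕ (c ⊕ ⊖ z) ≡ a ⊕ b ⊕ c
⊖-thrice = toWitness {a? = all? λ a → all? λ b → all? λ c → all? λ z →
  (a ⊕ ⊖ z) ⊕ (b ⊕ ⊖ z) ⊕ (c ⊕ ⊖ z) ≟ a ⊕ b ⊕ c} tt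

⊖-shift : ∀ a b z → a ⊕ ⊖ b ≡ (a ⊕ ⊖ z) ⊕ ⊖ (b ⊕ ⊖ z)
⊖-shift = toWitness {a? = all? λ a → all? λ b → all? λ z → a ⊕ ⊖ b ≟ (a ⊕ ⊖ z) ⊕ ⊖ (b ⊕ ⊖ z)} tt

C₃-commutativeMonoid : CommutativeMonoid _ _
C₃-commutativeMonoid = record
  { Carrier = C₃ ; _≈_ = _≡_ ; _∙_ = _⊕_ ; ε = zero
  ; isCommutativeMonoid = record
    { isMonoid = record
      { isSemigroup = record
        { isMagma = record { isEquivalence = isEquivalence ; ∙-cong = cong₂ _⊕_ }
        ; assoc = ⊕-assoc }
      ; identity = (λ _ → refl) , ⊕-identityʳ }
    ; comm = ⊕-comm } }

open CommutativeMonoidSum C₃-commutativeMonoid using (sum; sum-permute; sum-cong-≗; ∑-distrib-+)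

negᵥ : ∀ {n} → Pt n → Pt n
negᵥ = map ⊖_

infixl 6 _-ᵥ_
_-ᵥ_ : ∀ {n} → Pt n → Pt n → Pt n
x -ᵥ y = x +ᵥ negᵥ y

vec-ext : ∀ {n} {x y : Pt n} → (∀ k → lookup x k ≡ lookup y k) → x ≡ y
vec-ext {x = x} {y} h = trans (sym (tabulate∘lookup x)) (trans (tabulate-cong h) (tabulate∘lookup y))

infixl 6 _⊞_ _⊟_
data Term (k : ℕ) : Set where
  var     : Fin k → Term k
  ◯       : Term k
  _⊞_ _⊟_ : Term k → Term k → Term k

v₀ : ∀ {k} → Term (suc k)
v₀ = var zero

v₁ : ∀ {k} → Term (suc (suc k))
v₁ = var (suc zero)

v₂ : ∀ {k} → Term (suc (suc (suc k)))
v₂ = var (suc (suc zero))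

v₃ : ∀ {k} → Term (suc (suc (suc (suc k))))
v₃ = var (suc (suc (suc zero)))

v₄ : ∀ {k} → Term (suc (suc (suc (suc (suc k)))))
v₄ = var (suc (suc (suc (suc zero))))

v₅ : ∀ {k} → Term (suc (suc (suc (suc (suc (suc k))))))
v₅ = var (suc (suc (suc (suc (suc zero)))))

⟦_⟧ : ∀ {k n} → Term k → Vec (Pt n) k → Pt n
⟦ var i ⟧ γ = lookup γ i
⟦ ◯ ⟧     γ = 0ᵥ
⟦ s ⊞ t ⟧ γ = ⟦ s ⟧ γ +ᵥ ⟦ t ⟧ γ
⟦ s ⊟ t ⟧ γ = ⟦ s ⟧ γ -ᵥ ⟦ t ⟧ γ

⟦_⟧₃ : ∀ {k} → Term k → Vec C₃ k → C₃
⟦ var i ⟧₃ γ = lookup γ i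
⟦ ◯ ⟧₃     γ = zero
⟦ s ⊞ t ⟧₃ γ = ⟦ s ⟧₃ γ ⊕ ⟦ t ⟧₃ γ
⟦ s ⊟ t ⟧₃ γ = ⟦ s ⟧₃ γ ⊕ ⊖ ⟦ t ⟧₃ γ

lookup-⟦⟧ : ∀ {k n} (t : Term k) (γ : Vec (Pt n) k) j →
            lookup (⟦ t ⟧ γ) j ≡ ⟦ t ⟧₃ (map (λ x → lookup x j) γ)
lookup-⟦⟧ (var i) γ j = sym (lookup-map i (λ x → lookup x j) γ)
lookup-⟦⟧ ◯       γ j = lookup-replicate j zero
lookup-⟦⟧ (s ⊞ t) γ j =
  trans (lookup-zipWith _⊕_ j (⟦ s ⟧ γ) (⟦ t ⟧ γ)) (cong₂ _⊕_ (lookup-⟦⟧ s γ j) (lookup-⟦⟧ t γ j))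
lookup-⟦⟧ (s ⊟ t) γ j =
  trans (lookup-zipWith _⊕_ j (⟦ s ⟧ γ) (negᵥ (⟦ t ⟧ γ)))
        (cong₂ _⊕_ (lookup-⟦⟧ s γ j) (trans (lookup-map j ⊖_ (⟦ t ⟧ γ)) (cong ⊖_ (lookup-⟦⟧ t γ j))))

∀-Vec? : ∀ {m} k {P : Vec (Fin m) k → Set} → (∀ v → Dec (P v)) → Dec (∀ v → P v)
∀-Vec? zero    P? = map′ (λ p → λ { [] → p }) (λ h → h []) (P? [])
∀-Vec? (suc k) P? = map′ (λ p → λ { (a ∷ v) → p a v }) (λ h a v → h (a ∷ v))
                         (all? λ a → ∀-Vec? k λ v → P? (a ∷ v))

holds? : ∀ {k} (l r : Term k) → Dec (∀ γ → ⟦ l ⟧₃ γ ≡ ⟦ r ⟧₃ γ)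
holds? {k} l r = ∀-Vec? k λ γ → ⟦ l ⟧₃ γ ≟ ⟦ r ⟧₃ γ

solve : ∀ {k n} (l r : Term k) → True (holds? l r) → (γ : Vec (Pt n) k) → ⟦ l ⟧ γ ≡ ⟦ r ⟧ γ
solve l r valid γ = vec-ext λ j →
  trans (lookup-⟦⟧ l γ j) (trans (toWitness valid _) (sym (lookup-⟦⟧ r γ j)))

+-identityʳ : ∀ {n} (x : Pt n) → x +ᵥ 0ᵥ ≡ x
+-identityʳ x = solve (v₀ ⊞ ◯) v₀ _ (x ∷ [])

+-identityˡ : ∀ {n} (x : Pt n) → 0ᵥ +ᵥ x ≡ x
+-identityˡ x = solve (◯ ⊞ v₀) v₀ _ (x ∷ [])

+-∸ : ∀ {n} (x y : Pt n) → x +ᵥ y -ᵥ y ≡ x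
+-∸ x y = solve (v₀ ⊞ v₁ ⊟ v₁) v₀ _ (x ∷ y ∷ [])

∸-+ : ∀ {n} (x y : Pt n) → x -ᵥ y +ᵥ y ≡ x
∸-+ x y = solve (v₀ ⊟ v₁ ⊞ v₁) v₀ _ (x ∷ y ∷ [])

move-right : ∀ {n} {x y z : Pt n} → x +ᵥ y ≡ z → x ≡ z -ᵥ y
move-right {x = x} {y} refl = sym (+-∸ x y)

cancelʳ : ∀ {n} {x y z : Pt n} → x +ᵥ z ≡ y +ᵥ z → x ≡ y
cancelʳ {x = x} {y} {z} h = trans (sym (+-∸ x z)) (trans (cong (_-ᵥ z) h) (+-∸ y z))

cancelˡ : ∀ {n} {x y z : Pt n} → z +ᵥ x ≡ z +ᵥ y → x ≡ y
cancelˡ {x = x} {y} {z} h = cancelʳ (trans (solve (v₀ ⊞ v₁) (v₁ ⊞ v₀) _ (x ∷ z ∷ []))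
                                    (trans h (solve (v₁ ⊞ v₀) (v₀ ⊞ v₁) _ (y ∷ z ∷ []))))

∸-cancelˡ : ∀ {n} {x y z : Pt n} → z -ᵥ x ≡ z -ᵥ y → x ≡ y
∸-cancelˡ {x = x} {y} {z} h =
  trans (solve v₀ (v₁ ⊟ (v₁ ⊟ v₀)) _ (x ∷ z ∷ []))
        (trans (cong (z -ᵥ_) h) (solve (v₁ ⊟ (v₁ ⊟ v₀)) v₀ _ (y ∷ z ∷ [])))

Additive : ∀ {n} → (Pt n → Pt n) → Set
Additive h = ∀ x y → h (x +ᵥ y) ≡ h x +ᵥ h y

additive-0 : ∀ {n} {h : Pt n → Pt n} → Additive h → h 0ᵥ ≡ 0ᵥ
additive-0 {h = h} add = cancelʳ {z = h 0ᵥ}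
  (trans (sym (add 0ᵥ 0ᵥ)) (trans (cong h (+-identityʳ 0ᵥ)) (sym (+-identityˡ (h 0ᵥ)))))

additive-∸ : ∀ {n} {h : Pt n → Pt n} → Additive h → ∀ x y → h (x -ᵥ y) ≡ h x -ᵥ h y
additive-∸ {h = h} add x y = move-right (trans (sym (add (x -ᵥ y) y)) (cong h (∸-+ x y)))

Σ-0 : ∀ {n} → Σᵥ (0ᵥ {n}) ≡ zero
Σ-0 {zero}  = refl
Σ-0 {suc n} = Σ-0 {n}

Σ-unit : ∀ {n} (i : Fin n) → Σᵥ (unit i) ≡ suc zero
Σ-unit {suc n} zero    = cong (suc zero ⊕_) (Σ-0 {n})
Σ-unit {suc n} (suc i) = Σ-unit i

Σ-neg : ∀ {n} (x : Pt n) → Σᵥ (negᵥ x) ≡ ⊖ Σᵥ x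
Σ-neg []      = refl
Σ-neg (a ∷ x) = trans (cong (⊖ a ⊕_) (Σ-neg x)) (sym (⊖-distrib-⊕ a (Σᵥ x)))

Σ-lookup : ∀ {n} (x : Pt n) → Σᵥ x ≡ sum (lookup x)
Σ-lookup []      = refl
Σ-lookup (a ∷ x) = cong (a ⊕_) (Σ-lookup x)

Σ-+ : ∀ {n} (x y : Pt n) → Σᵥ (x +ᵥ y) ≡ Σᵥ x ⊕ Σᵥ y
Σ-+ x y = begin
  Σᵥ (x +ᵥ y)                                ≡⟨ Σ-lookup (x +ᵥ y) ⟩
  sum (lookup (x +ᵥ y))                      ≡⟨ sum-cong-≗ (λ k → lookup-zipWith _⊕_ k x y) ⟩
  sum (λ k → lookup x k ⊕ lookup y k)        ≡⟨ ∑-distrib-+ (lookup x) (lookup y) ⟩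
  sum (lookup x) ⊕ sum (lookup y)            ≡⟨ sym (cong₂ _⊕_ (Σ-lookup x) (Σ-lookup y)) ⟩
  Σᵥ x ⊕ Σᵥ y                                ∎
  where open ≡-Reasoning

bit : Bool → C₃
bit true  = suc zero
bit false = zero

bit-one : ∀ {b} → bit b ≡ suc zero → b ≡ true
bit-one {true} _ = refl

same : ∀ {m} (a : Fin m) → does (a ≟ a) ≡ true
same a = dec-true (a ≟ a) refl

different : ∀ {m} {a t : Fin m} → a ≢ t → does (a ≟ t) ≡ false
different {a = a} {t} = dec-false (a ≟ t)

from-true : ∀ {m} {a t : Fin m} → does (a ≟ t) ≡ true → a ≡ t
from-true {a = a} {t} h with a ≟ t
... | yes a≡t = a≡t
... | no  _   with () ← h

χ : ∀ {m} → Fin m → Fin m → C₃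
χ a t = bit (does (a ≟ t))

χ-self : ∀ {m} (a : Fin m) → χ a a ≡ suc zero
χ-self a = cong bit (same a)

χ-other : ∀ {m} {a t : Fin m} → a ≢ t → χ a t ≡ zero
χ-other a≢t = cong bit (different a≢t)

lookup-unit : ∀ {n} (i k : Fin n) → lookup (unit i) k ≡ χ i k
lookup-unit {suc n} zero    zero    = refl
lookup-unit {suc n} zero    (suc k) = lookup-replicate k zero
lookup-unit {suc n} (suc i) zero    = refl
lookup-unit {suc n} (suc i) (suc k) = lookup-unit i k

χ-permute : ∀ {m} (σ : S m) a t → χ a (σ ⟨$⟩ˡ t) ≡ χ (σ ⟨$⟩ʳ a) t
χ-permute σ a t with (σ ⟨$⟩ʳ a) ≟ t
... | yes refl = trans (cong (χ a) (inverseˡ σ)) (χ-self a)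
... | no  σa≢t = χ-other (λ a≡σ⁻¹t → σa≢t (trans (cong (σ ⟨$⟩ʳ_) a≡σ⁻¹t) (inverseʳ σ)))

hat : ∀ {n} → Pt n → Fin (suc n) → C₃
hat x zero    = ⊖ Σᵥ x
hat x (suc k) = lookup x k

hat-injective : ∀ {n} {x y : Pt n} → (∀ t → hat x t ≡ hat y t) → x ≡ y
hat-injective h = vec-ext (h ∘ suc)

hat-+ : ∀ {n} (x y : Pt n) t → hat (x +ᵥ y) t ≡ hat x t ⊕ hat y t
hat-+ x y zero    = trans (cong ⊖_ (Σ-+ x y)) (⊖-distrib-⊕ (Σᵥ x) (Σᵥ y))
hat-+ x y (suc k) = lookup-zipWith _⊕_ k x y

hat-∸ : ∀ {n} (x y : Pt n) t → hat (x -ᵥ y) t ≡ hat x t ⊕ ⊖ hat y t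
hat-∸ x y t = trans (hat-+ x (negᵥ y) t) (cong (hat x t ⊕_) (hat-neg t))
  where
  hat-neg : ∀ t → hat (negᵥ y) t ≡ ⊖ hat y t
  hat-neg zero    = cong ⊖_ (Σ-neg y)
  hat-neg (suc k) = lookup-map k ⊖_ y

sum-hat : ∀ {n} (x : Pt n) → sum (hat x) ≡ zero
sum-hat x = trans (cong (⊖ Σᵥ x ⊕_) (sym (Σ-lookup x))) (⊖-inverseˡ (Σᵥ x))

hat-e : ∀ {n} (a t : Fin (suc n)) → hat (e a) t ≡ χ a t ⊕ ⊖ χ zero t
hat-e {n} zero    zero    = cong ⊖_ (Σ-0 {n})
hat-e     zero    (suc k) = lookup-replicate k zero
hat-e     (suc i) zero    = cong ⊖_ (Σ-unit i)
hat-e     (suc i) (suc k) = trans (lookup-unit i k) (sym (⊕-identityʳ (χ i k)))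

-- Distinct labels give distinct unit vectors: compare the a-th homogeneous coordinates.
e-injective : ∀ {n} {a b : Fin (suc n)} → e a ≡ e b → a ≡ b
e-injective {a = a} {b} h = sym (from-true (bit-one (trans χba≡χaa (χ-self a))))
  where
  χba≡χaa : χ b a ≡ χ a a
  χba≡χaa = ⊕-cancelʳ _ _ (⊖ χ zero a)
    (trans (sym (hat-e b a)) (trans (cong (λ v → hat v a) (sym h)) (hat-e a a)))

-- The coordinates of a sum of three unit vectors are indicator sums (exponent 3).
hat-e₃ : ∀ {n} (a b c t : Fin (suc n)) → hat (e a +ᵥ e b +ᵥ e c) t ≡ χ a t ⊕ χ b t ⊕ χ c t
hat-e₃ a b c t = begin
  hat (e a +ᵥ e b +ᵥ e c) t                   ≡⟨ hat-+ (e a +ᵥ e b) (e c) t ⟩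
  hat (e a +ᵥ e b) t ⊕ hat (e c) t            ≡⟨ cong (_⊕ hat (e c) t) (hat-+ (e a) (e b) t) ⟩
  hat (e a) t ⊕ hat (e b) t ⊕ hat (e c) t     ≡⟨ cong₂ _⊕_ (cong₂ _⊕_ (hat-e a t) (hat-e b t)) (hat-e c t) ⟩
  (χ a t ⊕ ⊖ z) ⊕ (χ b t ⊕ ⊖ z) ⊕ (χ c t ⊕ ⊖ z) ≡⟨ ⊖-thrice (χ a t) (χ b t) (χ c t) z ⟩
  χ a t ⊕ χ b t ⊕ χ c t                       ∎
  where
  open ≡-Reasoning
  z = χ zero t

-- The action ρ of S_{n+1} on (C₃)ⁿ, permuting homogeneous coordinates: (ρ σ x)^ = x̂ ∘ σ⁻¹.
ρ : ∀ {n} → S (suc n) → Pt n → Pt n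
ρ σ x = tabulate (λ k → hat x (σ ⟨$⟩ˡ suc k))

-- The defining property also holds at coordinate 0, since homogeneous coordinates sum to 0.
hat-ρ : ∀ {n} (σ : S (suc n)) (x : Pt n) t → hat (ρ σ x) t ≡ hat x (σ ⟨$⟩ˡ t)
hat-ρ σ x (suc k) = lookup∘tabulate _ k
hat-ρ σ x zero    = trans (cong ⊖_ (Σ-lookup (ρ σ x)))
  (trans (cong ⊖_ (sum-cong-≗ (lookup∘tabulate (hat x ∘ (σ ⟨$⟩ˡ_) ∘ suc))))
         (⊖-unique _ _ (trans (sym (sum-permute (hat x) (flip σ))) (sum-hat x))))

inverse-cong : ∀ {m} (σ τ : S m) → σ ≈ τ → ∀ i → σ ⟨$⟩ˡ i ≡ τ ⟨$⟩ˡ i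
inverse-cong σ τ σ≈τ i = trans (cong (σ ⟨$⟩ˡ_) (sym (trans (σ≈τ (τ ⟨$⟩ˡ i)) (inverseʳ τ))))
                                       (inverseˡ σ)

ρ-cong : ∀ {n} (σ τ : S (suc n)) → σ ≈ τ → ∀ x → ρ σ x ≡ ρ τ x
ρ-cong σ τ σ≈τ x = tabulate-cong λ k → cong (hat x) (inverse-cong σ τ σ≈τ (suc k))

ρ-comp : ∀ {n} (σ τ : S (suc n)) x → ρ (σ · τ) x ≡ ρ σ (ρ τ x)
ρ-comp σ τ x = tabulate-cong λ k → sym (hat-ρ τ x (σ ⟨$⟩ˡ suc k))

ρ-+ : ∀ {n} (σ : S (suc n)) → Additive (ρ σ)
ρ-+ σ x y = hat-injective λ t → begin
  hat (ρ σ (x +ᵥ y)) t                      ≡⟨ hat-ρ σ (x +ᵥ y) t ⟩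
  hat (x +ᵥ y) (σ ⟨$⟩ˡ t)                   ≡⟨ hat-+ x y (σ ⟨$⟩ˡ t) ⟩
  hat x (σ ⟨$⟩ˡ t) ⊕ hat y (σ ⟨$⟩ˡ t)       ≡⟨ sym (cong₂ _⊕_ (hat-ρ σ x t) (hat-ρ σ y t)) ⟩
  hat (ρ σ x) t ⊕ hat (ρ σ y) t             ≡⟨ sym (hat-+ (ρ σ x) (ρ σ y) t) ⟩
  hat (ρ σ x +ᵥ ρ σ y) t                    ∎
  where open ≡-Reasoning

ρ-inverse : ∀ {n} (σ : S (suc n)) x → ρ (flip σ) (ρ σ x) ≡ x
ρ-inverse σ x = hat-injective λ t →
  trans (hat-ρ (flip σ) (ρ σ x) t) (trans (hat-ρ σ x _) (cong (hat x) (inverseˡ σ)))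

ρ-inverse′ : ∀ {n} (σ : S (suc n)) x → ρ σ (ρ (flip σ) x) ≡ x
ρ-inverse′ σ x = hat-injective λ t →
  trans (hat-ρ σ (ρ (flip σ) x) t) (trans (hat-ρ (flip σ) x _) (cong (hat x) (inverseʳ σ)))

-- The translation ν σ = e (σ 0) by which lines move relative to points.
ν : ∀ {n} → S (suc n) → Pt n
ν σ = e (σ ⟨$⟩ʳ zero)

ρ-e : ∀ {n} (σ : S (suc n)) a → ρ σ (e a) ≡ e (σ ⟨$⟩ʳ a) -ᵥ ν σ
ρ-e σ a = hat-injective λ t → begin
  hat (ρ σ (e a)) t                                 ≡⟨ hat-ρ σ (e a) t ⟩
  hat (e a) (σ ⟨$⟩ˡ t)                              ≡⟨ hat-e a _ ⟩
  χ a (σ ⟨$⟩ˡ t) ⊕ ⊖ χ zero (σ ⟨$⟩ˡ t)              ≡⟨ cong₂ (λ u v → u ⊕ ⊖ v) (χ-permute σ a t) (χ-permute σ zero t) ⟩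
  χ (σ ⟨$⟩ʳ a) t ⊕ ⊖ χ (σ ⟨$⟩ʳ zero) t              ≡⟨ ⊖-shift (χ (σ ⟨$⟩ʳ a) t) (χ (σ ⟨$⟩ʳ zero) t) (χ zero t) ⟩
  (χ (σ ⟨$⟩ʳ a) t ⊕ ⊖ χ zero t) ⊕ ⊖ (χ (σ ⟨$⟩ʳ zero) t ⊕ ⊖ χ zero t)
                                                    ≡⟨ sym (cong₂ (λ u v → u ⊕ ⊖ v) (hat-e (σ ⟨$⟩ʳ a) t) (hat-e (σ ⟨$⟩ʳ zero) t)) ⟩
  hat (e (σ ⟨$⟩ʳ a)) t ⊕ ⊖ hat (ν σ) t              ≡⟨ sym (hat-∸ (e (σ ⟨$⟩ʳ a)) (ν σ) t) ⟩
  hat (e (σ ⟨$⟩ʳ a) -ᵥ ν σ) t                       ∎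
  where open ≡-Reasoning

ρ-φ : ∀ {n} (s : Fin n) x → ρ (transpose zero (suc s)) x ≡ φ s x
ρ-φ s x = vec-ext λ k → trans (lookup∘tabulate _ k) (coordinate k)
  where
  coordinate : ∀ k → hat x (PC.transpose (suc s) zero (suc k)) ≡ lookup (φ s x) k
  coordinate k with k ≟ s
  ... | yes refl = sym (lookup∘update k x _)
  ... | no  k≢s  = sym (lookup∘update′ k≢s x _)

transpose-sym : ∀ {n} (i j k : Fin n) → PC.transpose j i k ≡ PC.transpose i j k
transpose-sym i j k with k ≟ i | k ≟ j
... | yes refl | yes refl = refl
... | yes refl | no  _    rewrite dec-true (k ≟ k) refl = refl
... | no  _    | yes refl rewrite dec-true (k ≟ k) refl = refl
... | no  k≢i  | no  k≢j  rewrite dec-false (k ≟ i) k≢i | dec-false (k ≟ j) k≢j = refl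

ρ-swap : ∀ {n} (i j : Fin n) x → ρ (transpose (suc i) (suc j)) x ≡ swapᶜ i j x
ρ-swap i j x = tabulate-cong λ k →
  cong (hat x) (trans (lift₀-transpose j i (suc k)) (cong suc (transpose-sym i j k)))

ρ-translate : ∀ {n} (σ : S (suc n)) c i → ρ σ (c +ᵥ e i) ≡ ρ σ c -ᵥ ν σ +ᵥ e (σ ⟨$⟩ʳ i)
ρ-translate σ c i = begin
  ρ σ (c +ᵥ e i)                  ≡⟨ ρ-+ σ c (e i) ⟩
  ρ σ c +ᵥ ρ σ (e i)              ≡⟨ cong (ρ σ c +ᵥ_) (ρ-e σ i) ⟩
  ρ σ c +ᵥ (e (σ ⟨$⟩ʳ i) -ᵥ ν σ)  ≡⟨ solve (v₀ ⊞ (v₁ ⊟ v₂)) (v₀ ⊟ v₂ ⊞ v₁) _ (ρ σ c ∷ e (σ ⟨$⟩ʳ i) ∷ ν σ ∷ []) ⟩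
  ρ σ c -ᵥ ν σ +ᵥ e (σ ⟨$⟩ʳ i)    ∎
  where open ≡-Reasoning

module Affine {n} (σ : S (suc n)) (b : Pt n) where

  point : Pt n → Pt n
  point x = ρ σ x +ᵥ b

  line : Pt n → Pt n
  line c = point c -ᵥ ν σ

  point-translate : ∀ c i → point (c +ᵥ e i) ≡ line c +ᵥ e (σ ⟨$⟩ʳ i)
  point-translate c i = trans (cong (_+ᵥ b) (ρ-translate σ c i))
    (solve (v₀ ⊟ v₁ ⊞ v₂ ⊞ v₃) (v₀ ⊞ v₃ ⊟ v₁ ⊞ v₂) _ (ρ σ c ∷ ν σ ∷ e (σ ⟨$⟩ʳ i) ∷ b ∷ []))

  point-injective : ∀ {x y} → point x ≡ point y → x ≡ y
  point-injective {x} {y} h =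
    trans (sym (ρ-inverse σ x)) (trans (cong (ρ (flip σ)) (cancelʳ h)) (ρ-inverse σ y))

  preserves : ∀ x c → x I c → point x I line c
  preserves x c (i , refl) = σ ⟨$⟩ʳ i , point-translate c i

  reflects : ∀ x c → point x I line c → x I c
  reflects x c (j , h) = σ ⟨$⟩ˡ j , point-injective (begin
    point x                                  ≡⟨ h ⟩
    line c +ᵥ e j                            ≡⟨ cong (λ k → line c +ᵥ e k) (sym (inverseʳ σ)) ⟩
    line c +ᵥ e (σ ⟨$⟩ʳ (σ ⟨$⟩ˡ j))          ≡⟨ sym (point-translate c (σ ⟨$⟩ˡ j)) ⟩
    point (c +ᵥ e (σ ⟨$⟩ˡ j))                ∎)
    where open ≡-Reasoning

Ψ : ∀ {n} → S (suc n) → Pt n → Aut n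
Ψ σ b = record
  { pt  = mk↔ₛ′ point (λ y → ρ (flip σ) (y -ᵥ b))
            (λ y → trans (cong (_+ᵥ b) (ρ-inverse′ σ (y -ᵥ b))) (∸-+ y b))
            (λ x → trans (cong (ρ (flip σ)) (+-∸ (ρ σ x) b)) (ρ-inverse σ x))
  ; ln  = mk↔ₛ′ line (λ d → ρ (flip σ) (d +ᵥ ν σ -ᵥ b))
            (λ d → trans (cong (λ y → y +ᵥ b -ᵥ ν σ) (ρ-inverse′ σ (d +ᵥ ν σ -ᵥ b)))
                         (solve (v₀ ⊞ v₁ ⊟ v₂ ⊞ v₂ ⊟ v₁) v₀ _ (d ∷ ν σ ∷ b ∷ [])))
            (λ c → trans (cong (ρ (flip σ)) (solve (v₀ ⊞ v₁ ⊟ v₂ ⊞ v₂ ⊟ v₁) v₀ _ (ρ σ c ∷ b ∷ ν σ ∷ [])))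
                         (ρ-inverse σ c))
  ; inc = λ x c → mk⇔ (preserves x c) (reflects x c)
  }
  where open Affine σ b

Ψ-hom : ∀ {n} (σ : S (suc n)) a τ b → Ψ (σ · τ) (a +ᵥ ρ σ b) ≈ᴬ Ψ σ a ∘ᴬ Ψ τ b
Ψ-hom σ a τ b = on-points , on-lines
  where
  open ≡-Reasoning
  on-points : ∀ x → ρ (σ · τ) x +ᵥ (a +ᵥ ρ σ b) ≡ ρ σ (ρ τ x +ᵥ b) +ᵥ a
  on-points x = begin
    ρ (σ · τ) x +ᵥ (a +ᵥ ρ σ b)  ≡⟨ cong (_+ᵥ (a +ᵥ ρ σ b)) (ρ-comp σ τ x) ⟩
    ρ σ (ρ τ x) +ᵥ (a +ᵥ ρ σ b)  ≡⟨ solve (v₀ ⊞ (v₁ ⊞ v₂)) (v₀ ⊞ v₂ ⊞ v₁) _ (ρ σ (ρ τ x) ∷ a ∷ ρ σ b ∷ []) ⟩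
    ρ σ (ρ τ x) +ᵥ ρ σ b +ᵥ a    ≡⟨ cong (_+ᵥ a) (sym (ρ-+ σ (ρ τ x) b)) ⟩
    ρ σ (ρ τ x +ᵥ b) +ᵥ a        ∎
  on-lines : ∀ c → ρ (σ · τ) c +ᵥ (a +ᵥ ρ σ b) -ᵥ ν (σ · τ) ≡ ρ σ (ρ τ c +ᵥ b -ᵥ ν τ) +ᵥ a -ᵥ ν σ
  on-lines c = begin
    ρ (σ · τ) c +ᵥ (a +ᵥ ρ σ b) -ᵥ ν (σ · τ)  ≡⟨ cong (_-ᵥ ν (σ · τ)) (on-points c) ⟩
    ρ σ y +ᵥ a -ᵥ ν (σ · τ)                   ≡⟨ solve (v₀ ⊞ v₁ ⊟ v₂) (v₀ ⊟ (v₂ ⊟ v₃) ⊞ v₁ ⊟ v₃) _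
                                                       (ρ σ y ∷ a ∷ ν (σ · τ) ∷ ν σ ∷ []) ⟩
    ρ σ y -ᵥ (ν (σ · τ) -ᵥ ν σ) +ᵥ a -ᵥ ν σ   ≡⟨ cong (λ z → ρ σ y -ᵥ z +ᵥ a -ᵥ ν σ) (sym (ρ-e σ (τ ⟨$⟩ʳ zero))) ⟩
    ρ σ y -ᵥ ρ σ (ν τ) +ᵥ a -ᵥ ν σ            ≡⟨ cong (λ z → z +ᵥ a -ᵥ ν σ) (sym (additive-∸ (ρ-+ σ) y (ν τ))) ⟩
    ρ σ (y -ᵥ ν τ) +ᵥ a -ᵥ ν σ                ∎
    where
    y : Pt _
    y = ρ τ c +ᵥ b

-- Ψ is injective: the image of 0 recovers b, the lines recover ν σ, the units recover σ.
Ψ-injective : ∀ {n} (σ : S (suc n)) a τ b → Ψ σ a ≈ᴬ Ψ τ b → (σ ≈ τ) × (a ≡ b)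
Ψ-injective σ a τ b (same-points , same-lines) = σ≈τ , a≡b
  where
  at-origin : ∀ π c → ρ π 0ᵥ +ᵥ c ≡ c
  at-origin π c = trans (cong (_+ᵥ c) (additive-0 (ρ-+ π))) (+-identityˡ c)
  a≡b : a ≡ b
  a≡b = trans (sym (at-origin σ a)) (trans (same-points 0ᵥ) (at-origin τ b))
  ν-equal : ν σ ≡ ν τ
  ν-equal = ∸-cancelˡ (trans (cong (_-ᵥ ν σ) (sym (at-origin σ a)))
                      (trans (same-lines 0ᵥ) (cong (_-ᵥ ν τ) (trans (at-origin τ b) (sym a≡b)))))
  σ≈τ : σ ≈ τ
  σ≈τ i = e-injective (cancelʳ {z = negᵥ (ν σ)} (begin
    e (σ ⟨$⟩ʳ i) -ᵥ ν σ   ≡⟨ sym (ρ-e σ i) ⟩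
    ρ σ (e i)             ≡⟨ cancelʳ (trans (same-points (e i)) (cong (ρ τ (e i) +ᵥ_) (sym a≡b))) ⟩
    ρ τ (e i)             ≡⟨ ρ-e τ i ⟩
    e (τ ⟨$⟩ʳ i) -ᵥ ν τ   ≡⟨ cong (e (τ ⟨$⟩ʳ i) -ᵥ_) (sym ν-equal) ⟩
    e (τ ⟨$⟩ʳ i) -ᵥ ν σ   ∎))
    where open ≡-Reasoning

bits₃ : Bool → Bool → Bool → C₃
bits₃ a b c = bit a ⊕ bit b ⊕ bit c

specialise : ∀ {a b c d e f a′ b′ c′ d′ e′ f′} →
             a ≡ a′ → b ≡ b′ → c ≡ c′ → d ≡ d′ → e ≡ e′ → f ≡ f′ →
             bits₃ a b c ≡ bits₃ d e f → bits₃ a′ b′ c′ ≡ bits₃ d′ e′ f′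
specialise refl refl refl refl refl refl h = h

-- The four evaluations of bit sums used below (1 + 1 = 2 is not a bit, 1 + 1 + 1 = 0).
bits-10x : ∀ x y → bits₃ true false x ≡ bits₃ false false y → y ≡ true
bits-10x _     true  _ = refl
bits-10x false false ()
bits-10x true  false ()

bits-01x : ∀ x y → bits₃ false true x ≡ bits₃ false y false → y ≡ true
bits-01x _     true  _ = refl
bits-01x false false ()
bits-01x true  false ()

bits-11x : ∀ x y → bits₃ true true x ≡ bits₃ false false y → x ≡ true
bits-11x true  _     _ = refl
bits-11x false false ()
bits-11x false true  ()

bits-000 : ∀ y z → bits₃ false false false ≡ bits₃ true y z → y ≡ true
bits-000 true  _     _ = refl
bits-000 false false ()
bits-000 false true  ()

triples-apart : ∀ {m} {p q u v r s : Fin m} →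
  (∀ t → χ q t ⊕ χ u t ⊕ χ s t ≡ χ p t ⊕ χ v t ⊕ χ r t) →
  p ≢ q → u ≢ p → v ≢ q → u ≢ q → v ≡ u
triples-apart {p = p} {q} {u} {v} {r} {s} eq p≢q u≢p v≢q u≢q =
  from-true (bits-01x (does (s ≟ u)) (does (v ≟ u))
    (specialise (different (u≢q ∘ sym)) (same u) refl (different (u≢p ∘ sym)) refl
                (different (λ r≡u → u≢q (trans (sym r≡u) r≡q))) (eq u)))
  where
  r≡q : r ≡ q
  r≡q = from-true (bits-10x (does (s ≟ q)) (does (r ≟ q))
    (specialise (same q) (different u≢q) refl (different p≢q) (different v≢q) refl (eq q)))

triples-meet : ∀ {m} {p q v r s : Fin m} →
  (∀ t → χ q t ⊕ χ q t ⊕ χ s t ≡ χ p t ⊕ χ v t ⊕ χ r t) →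
  p ≢ q → v ≢ q → v ≡ p
triples-meet {p = p} {q} {v} {r} {s} eq p≢q v≢q =
  from-true (bits-000 (does (v ≟ p)) (does (r ≟ p))
    (specialise (different (p≢q ∘ sym)) (different (p≢q ∘ sym))
                (different (λ s≡p → p≢q (trans (sym s≡p) s≡q))) (same p) refl refl (eq p)))
  where
  s≡q : s ≡ q
  s≡q = from-true (bits-11x (does (s ≟ q)) (does (r ≟ q))
    (specialise (same q) (same q) refl (different p≢q) (different v≢q) refl (eq q)))

indicator-triples : ∀ {m} {p q u v r s : Fin m} →
  (∀ t → χ q t ⊕ χ u t ⊕ χ s t ≡ χ p t ⊕ χ v t ⊕ χ r t) →
  p ≢ q → u ≢ p → v ≢ q → v ≡ u ⊎ (u ≡ q × v ≡ p)
indicator-triples {q = q} {u} {r = r} {s} eq p≢q u≢p v≢q with u ≟ q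
... | no  u≢q  = inj₁ (triples-apart {r = r} {s} eq p≢q u≢p v≢q u≢q)
... | yes refl = inj₂ (refl , triples-meet {r = r} {s} eq p≢q v≢q)

joined-labels : ∀ {n} {X G₁ G₂ W : Pt n} {p q u v r s : Fin (suc n)} →
  X ≡ G₁ +ᵥ e p → X ≡ G₂ +ᵥ e q → G₁ +ᵥ e u ≡ W +ᵥ e r → G₂ +ᵥ e v ≡ W +ᵥ e s →
  p ≢ q → u ≢ p → v ≢ q → v ≡ u ⊎ (u ≡ q × v ≡ p)
joined-labels {X = X} {G₁} {G₂} {W} {p} {q} {u} {v} {r} {s} h₁ h₂ h₃ h₄ =
  indicator-triples {r = r} {s} indicators
  where
  open ≡-Reasoning
  relation : e q +ᵥ e u +ᵥ e s ≡ e p +ᵥ e v +ᵥ e r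
  relation = begin
    e q +ᵥ e u +ᵥ e s
      ≡⟨ solve (v₃ ⊞ v₄ ⊞ v₅) (v₁ ⊞ v₃ ⊞ (v₀ ⊞ v₄) ⊞ (v₂ ⊞ v₅) ⊟ v₀ ⊟ v₁ ⊟ v₂) _
               (G₁ ∷ G₂ ∷ W ∷ e q ∷ e u ∷ e s ∷ []) ⟩
    (G₂ +ᵥ e q) +ᵥ (G₁ +ᵥ e u) +ᵥ (W +ᵥ e s) -ᵥ G₁ -ᵥ G₂ -ᵥ W
      ≡⟨ cong (λ z → z -ᵥ G₁ -ᵥ G₂ -ᵥ W) (cong₂ _+ᵥ_ (cong₂ _+ᵥ_ (trans (sym h₂) h₁) h₃) (sym h₄)) ⟩
    (G₁ +ᵥ e p) +ᵥ (W +ᵥ e r) +ᵥ (G₂ +ᵥ e v) -ᵥ G₁ -ᵥ G₂ -ᵥ W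
      ≡⟨ solve (v₀ ⊞ v₃ ⊞ (v₂ ⊞ v₄) ⊞ (v₁ ⊞ v₅) ⊟ v₀ ⊟ v₁ ⊟ v₂) (v₃ ⊞ v₅ ⊞ v₄) _
               (G₁ ∷ G₂ ∷ W ∷ e p ∷ e r ∷ e v ∷ []) ⟩
    e p +ᵥ e v +ᵥ e r ∎
  indicators : ∀ t → χ q t ⊕ χ u t ⊕ χ s t ≡ χ p t ⊕ χ v t ⊕ χ r t
  indicators t = trans (sym (hat-e₃ q u s t)) (trans (cong (λ z → hat z t) relation) (hat-e₃ p v r t))

-- Three elements do not exhaust a set of more than three elements: otherwise
-- four distinct candidates would be sent injectively into the three.
module _ {m} (3<m : 3 < m) (x y z : Fin m) where

  private
    Fresh : Fin m → Set
    Fresh w = w ≢ x × w ≢ y × w ≢ z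

    candidate : Fin 4 → Fin m
    candidate k = inject≤ k 3<m

    among : Fin 3 → Fin m
    among zero             = x
    among (suc zero)       = y
    among (suc (suc zero)) = z

    covered : ∀ k → ¬ Fresh (candidate k) → ∃ λ c → candidate k ≡ among c
    covered k not-fresh with candidate k ≟ x | candidate k ≟ y | candidate k ≟ z
    ... | yes h | _     | _     = zero , h
    ... | no _  | yes h | _     = suc zero , h
    ... | no _  | no _  | yes h = suc (suc zero) , h
    ... | no a  | no b  | no c  = ⊥-elim (not-fresh (a , b , c))

  fresh : ∃ λ w → w ≢ x × w ≢ y × w ≢ z
  fresh with any? (λ k → ¬? (candidate k ≟ x) ×-dec ¬? (candidate k ≟ y) ×-dec ¬? (candidate k ≟ z))
  ... | yes (k , k-fresh) = candidate k , k-fresh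
  ... | no  none-fresh    = ⊥-elim (<⇒notInjective (s≤s (s≤s (s≤s (s≤s z≤n)))) position-injective)
    where
    position : Fin 4 → Fin 3
    position k = proj₁ (covered k (λ k-fresh → none-fresh (k , k-fresh)))
    position-injective : ∀ {k l} → position k ≡ position l → k ≡ l
    position-injective {k} {l} h = inject≤-injective 3<m 3<m k l
      (trans (proj₂ (covered k _)) (trans (cong among h) (sym (proj₂ (covered l _)))))

avoid : ∀ {m} → 3 < m → (h : Fin m → Fin m) → (∀ {i j} → h i ≡ h j → i ≡ j) →
        ∀ i a u → ∃ λ d → d ≢ i × d ≢ a × h d ≢ u
avoid 3<m h h-injective i a u with fresh 3<m i a i
... | d₁ , d₁≢i , d₁≢a , _ with h d₁ ≟ u
...   | no  hd₁≢u = d₁ , d₁≢i , d₁≢a , hd₁≢u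
...   | yes hd₁≡u with fresh 3<m i a d₁
...     | d₂ , d₂≢i , d₂≢a , d₂≢d₁ =
  d₂ , d₂≢i , d₂≢a , λ hd₂≡u → d₂≢d₁ (h-injective (trans hd₂≡u (sym hd₁≡u)))

unit-induction : ∀ {n} (P : Pt n → Set) → P 0ᵥ → (∀ x j → P x → P (x +ᵥ unit j)) → ∀ x → P x
unit-induction {zero}  P base step []      = base
unit-induction {suc n} P base step (a ∷ v) = first a
  where
  tail-case : ∀ v → P (zero ∷ v)
  tail-case = unit-induction (λ v → P (zero ∷ v)) base (λ x j → step (zero ∷ x) (suc j))
  add-e₀ : ∀ a → P (a ∷ v) → P ((a ⊕ suc zero) ∷ v)
  add-e₀ a p = subst (λ w → P ((a ⊕ suc zero) ∷ w)) (+-identityʳ v) (step (a ∷ v) zero p)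
  first : ∀ a → P (a ∷ v)
  first zero             = tail-case v
  first (suc zero)       = add-e₀ zero (tail-case v)
  first (suc (suc zero)) = add-e₀ (suc zero) (add-e₀ zero (tail-case v))

module Surjectivity {n} (2<n : 2 < n) (α : Aut n) where

  f g : Pt n → Pt n
  f = ptMap α
  g = lnMap α

  f-injective : ∀ {x y} → f x ≡ f y → x ≡ y
  f-injective {x} {y} h = trans (sym (Inverse.strictlyInverseʳ (pt α) x))
    (trans (cong (Inverse.from (pt α)) h) (Inverse.strictlyInverseʳ (pt α) y))

  g-injective : ∀ {x y} → g x ≡ g y → x ≡ y
  g-injective {x} {y} h = trans (sym (Inverse.strictlyInverseʳ (ln α) x))
    (trans (cong (Inverse.from (ln α)) h) (Inverse.strictlyInverseʳ (ln α) y))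

  π : Pt n → Fin (suc n) → Fin (suc n)
  π c i = proj₁ (Equivalence.to (inc α (c +ᵥ e i) c) (i , refl))

  π-spec : ∀ c i → f (c +ᵥ e i) ≡ g c +ᵥ e (π c i)
  π-spec c i = proj₂ (Equivalence.to (inc α (c +ᵥ e i) c) (i , refl))

  π-injective : ∀ c {i j} → π c i ≡ π c j → i ≡ j
  π-injective c {i} {j} h = e-injective (cancelˡ (f-injective
    (trans (π-spec c i) (trans (cong (λ k → g c +ᵥ e k) h) (sym (π-spec c j))))))

  module Pencil (x : Pt n) where

    L : Fin (suc n) → Pt n
    L i = x -ᵥ e i

    ψ : Fin (suc n) → Fin (suc n)
    ψ i = π (L i) i

    ψ-spec : ∀ i → f x ≡ g (L i) +ᵥ e (ψ i)
    ψ-spec i = trans (cong f (sym (∸-+ x (e i)))) (π-spec (L i) i)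

    ψ-injective : ∀ {i d} → ψ i ≡ ψ d → i ≡ d
    ψ-injective {i} {d} h = e-injective (∸-cancelˡ (g-injective (cancelʳ
      (trans (sym (ψ-spec i)) (trans (ψ-spec d) (cong (λ k → g (L d) +ᵥ e k) (sym h)))))))

    joined : ∀ {i d a a′} (W : Pt n) r s → i ≢ d → a ≢ i → a′ ≢ d →
             L i +ᵥ e a ≡ W +ᵥ e r → L d +ᵥ e a′ ≡ W +ᵥ e s →
             π (L d) a′ ≡ π (L i) a ⊎ (π (L i) a ≡ ψ d × π (L d) a′ ≡ ψ i)
    joined {i} {d} {a} {a′} W r s i≢d a≢i a′≢d on-W on-W′ = joined-labels {r = π W r} {s = π W s}
      (ψ-spec i) (ψ-spec d)
      (trans (sym (π-spec (L i) a)) (trans (cong f on-W) (π-spec W r)))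
      (trans (sym (π-spec (L d) a′)) (trans (cong f on-W′) (π-spec W s)))
      (i≢d ∘ ψ-injective) (a≢i ∘ π-injective (L i)) (a′≢d ∘ π-injective (L d))

    third-label : ∀ {i d a} → i ≢ d → a ≢ i → a ≢ d →
                  π (L d) a ≡ π (L i) a ⊎ (π (L i) a ≡ ψ d × π (L d) a ≡ ψ i)
    third-label {i} {d} {a} i≢d a≢i a≢d = joined (x -ᵥ e i -ᵥ e d +ᵥ e a) d i i≢d a≢i a≢d
      (solve (v₀ ⊟ v₁ ⊞ v₃) (v₀ ⊟ v₁ ⊟ v₂ ⊞ v₃ ⊞ v₂) _ (x ∷ e i ∷ e d ∷ e a ∷ []))
      (solve (v₀ ⊟ v₂ ⊞ v₃) (v₀ ⊟ v₁ ⊟ v₂ ⊞ v₃ ⊞ v₁) _ (x ∷ e i ∷ e d ∷ e a ∷ []))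

    -- L i + e d and L d + e i lie on the line x − e i − e i + e d (as 3 e d = 3 e i = 0).
    exchanged : ∀ {i d} → i ≢ d → π (L d) i ≡ π (L i) d ⊎ (π (L i) d ≡ ψ d × π (L d) i ≡ ψ i)
    exchanged {i} {d} i≢d = joined (x -ᵥ e i -ᵥ e i +ᵥ e d) i d i≢d (i≢d ∘ sym) i≢d
      (solve (v₀ ⊟ v₁ ⊞ v₂) (v₀ ⊟ v₁ ⊟ v₁ ⊞ v₂ ⊞ v₁) _ (x ∷ e i ∷ e d ∷ []))
      (solve (v₀ ⊟ v₂ ⊞ v₁) (v₀ ⊟ v₁ ⊟ v₁ ⊞ v₂ ⊞ v₂) _ (x ∷ e i ∷ e d ∷ []))

    -- Suppose the i-th line labels a by u ≠ ψ a.  For a line d ∉ {i, a} with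
    -- ψ d ≠ u, the a-th line gives both i and d the label u, so d = i.
    three-lines : ∀ {i a d} → a ≢ i → π (L i) a ≢ ψ a → d ≢ i → d ≢ a → ψ d ≢ π (L i) a → d ≡ i
    three-lines {i} {a} {d} a≢i u≢ψa d≢i d≢a ψd≢u = π-injective (L a) (trans at-d (sym at-i))
      where
      on-d : π (L d) a ≡ π (L i) a
      on-d = [ (λ same-label → same-label) , (λ hit → ⊥-elim (ψd≢u (sym (proj₁ hit)))) ]′
               (third-label (d≢i ∘ sym) a≢i (d≢a ∘ sym))
      at-i : π (L a) i ≡ π (L i) a
      at-i = [ (λ same-label → same-label) , (λ hit → ⊥-elim (u≢ψa (proj₁ hit))) ]′
               (exchanged (a≢i ∘ sym))
      at-d : π (L a) d ≡ π (L i) a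
      at-d = [ (λ same-label → trans (sym same-label) on-d)
             , (λ hit → ⊥-elim (u≢ψa (trans (sym on-d) (proj₂ hit)))) ]′
               (exchanged (d≢a ∘ sym))

    -- All lines through x label their points alike: this is where n > 2 is used.
    pencil-labels : ∀ i a → π (L i) a ≡ ψ a
    pencil-labels i a with a ≟ i
    ... | yes refl = refl
    ... | no  a≢i with π (L i) a ≟ ψ a
    ...   | yes agree    = agree
    ...   | no  disagree with avoid (s≤s 2<n) ψ ψ-injective i a (π (L i) a)
    ...     | d , d≢i , d≢a , ψd≢u = ⊥-elim (d≢i (three-lines a≢i disagree d≢i d≢a ψd≢u))

  π-step : ∀ c j a → π c a ≡ π (c +ᵥ e j) a
  π-step c j a = begin
    π c a          ≡⟨ cong (λ w → π w a) (sym (+-∸ c (e j))) ⟩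
    π (L j) a      ≡⟨ pencil-labels j a ⟩
    ψ a            ≡⟨ sym (pencil-labels zero a) ⟩
    π (L zero) a   ≡⟨ cong (λ w → π w a) (solve (v₀ ⊟ ◯) v₀ _ (c +ᵥ e j ∷ [])) ⟩
    π (c +ᵥ e j) a ∎
    where
    open ≡-Reasoning
    open Pencil (c +ᵥ e j)

  π-constant : ∀ c a → π c a ≡ π 0ᵥ a
  π-constant = unit-induction (λ c → ∀ a → π c a ≡ π 0ᵥ a) (λ _ → refl)
    (λ c j ih a → trans (sym (π-step c (suc j) a)) (ih a))

  preimage : ∀ j → ∃ λ k → f (0ᵥ +ᵥ e k) ≡ g 0ᵥ +ᵥ e j
  preimage j =
    let y  = Inverse.from (pt α) (g 0ᵥ +ᵥ e j)
        fy = Inverse.strictlyInverseˡ (pt α) (g 0ᵥ +ᵥ e j)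
        (k , y≡) = Equivalence.from (inc α y 0ᵥ) (j , fy)
    in k , trans (cong f (sym y≡)) fy

  -- σ = π 0, a permutation since every label on the line g 0 is attained.
  σ : S (suc n)
  σ = permutation (π 0ᵥ) (proj₁ ∘ preimage) π-preimage preimage-π
    where
    π-preimage : ∀ j → π 0ᵥ (proj₁ (preimage j)) ≡ j
    π-preimage j = e-injective (cancelˡ (trans (sym (π-spec 0ᵥ _)) (proj₂ (preimage j))))
    preimage-π : ∀ i → proj₁ (preimage (π 0ᵥ i)) ≡ i
    preimage-π i = π-injective 0ᵥ (π-preimage (π 0ᵥ i))

  b : Pt n
  b = f 0ᵥ

  open Affine σ b using (point-translate)

  -- The point c = c + e 0 of line c gives g c = f c − ν σ.
  lines-from-points : ∀ c → g c ≡ f c -ᵥ ν σ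
  lines-from-points c = move-right (sym (trans (cong f (sym (+-identityʳ c)))
    (trans (π-spec c zero) (cong (λ k → g c +ᵥ e k) (π-constant c zero)))))

  points : ∀ x → f x ≡ ρ σ x +ᵥ b
  points = unit-induction (λ x → f x ≡ ρ σ x +ᵥ b)
    (sym (trans (cong (_+ᵥ b) (additive-0 (ρ-+ σ))) (+-identityˡ b))) step
    where
    open ≡-Reasoning
    step : ∀ x j → f x ≡ ρ σ x +ᵥ b → f (x +ᵥ e (suc j)) ≡ ρ σ (x +ᵥ e (suc j)) +ᵥ b
    step x j ih = begin
      f (x +ᵥ e (suc j))                     ≡⟨ π-spec x (suc j) ⟩
      g x +ᵥ e (π x (suc j))                 ≡⟨ cong₂ (λ y k → y +ᵥ e k) (lines-from-points x) (π-constant x (suc j)) ⟩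
      f x -ᵥ ν σ +ᵥ e (σ ⟨$⟩ʳ suc j)          ≡⟨ cong (λ y → y -ᵥ ν σ +ᵥ e (σ ⟨$⟩ʳ suc j)) ih ⟩
      ρ σ x +ᵥ b -ᵥ ν σ +ᵥ e (σ ⟨$⟩ʳ suc j)   ≡⟨ sym (point-translate x (suc j)) ⟩
      ρ σ (x +ᵥ e (suc j)) +ᵥ b              ∎

  surjective : Ψ σ b ≈ᴬ α
  surjective = (λ x → sym (points x))
             , (λ c → sym (trans (lines-from-points c) (cong (_-ᵥ ν σ) (points c))))

proposition5p6 : (n : ℕ) → 2 < n →
    Σ (S (suc n) → Pt n → Pt n) λ ρ →
    Σ (S (suc n) → Pt n → Aut n) λ Ψ →
      ((∀ σ τ → σ ≈ τ → ∀ x → ρ σ x ≡ ρ τ x)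
       × (∀ σ τ x → ρ (σ · τ) x ≡ ρ σ (ρ τ x))
       × (∀ σ x y → ρ σ (x +ᵥ y) ≡ ρ σ x +ᵥ ρ σ y)
       × (∀ s x → ρ (transpose zero (suc s)) x ≡ φ s x)
       × (∀ i j x → ρ (transpose (suc i) (suc j)) x ≡ swapᶜ i j x))
      × (∀ σ b x → ptMap (Ψ σ b) x ≡ ρ σ x +ᵥ b)
      × (∀ σ a τ b → Ψ (σ · τ) (a +ᵥ ρ σ b) ≈ᴬ Ψ σ a ∘ᴬ Ψ τ b)
      × (∀ σ a τ b → Ψ σ a ≈ᴬ Ψ τ b → (σ ≈ τ) × (a ≡ b))
      × (∀ (α : Aut n) → ∃ λ σ → ∃ λ b → Ψ σ b ≈ᴬ α)
proposition5p6 n 2<n =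
  ρ , Ψ ,
  (ρ-cong , ρ-comp , ρ-+ , ρ-φ , ρ-swap) ,
  (λ σ b x → refl) ,
  Ψ-hom ,
  Ψ-injective ,
  λ α → let open Surjectivity 2<n α in σ , b , surjective
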